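{- For every $n\ge 3$, the sun $S_n$ is distance antimagic.
   Context: The sun $S_n$ is the graph on $2n$ vertices obtained from a cycle $C_n$ by attaching one pendant vertex (leaf) to each vertex of the cycle. For a graph $G$ with $v$ vertices, a distance antimagic labeling is a bijection $f:V(G)\to\{1,\ldots,v\}$ such that the vertex-weights $w(x)=\sum_{y\in N(x)} f(y)$ ($N(x)$ the set of neighbors of $x$) are pairwise distinct; $G$ is distance antimagic if it admits such a labeling. -}

module Defs where

open import Data.Nat using (ℕ; zero; suc; _+_; _%_; NonZero)
open import Data.Fin using (Fin; toℕ; splitAt)
open import Data.Bool using (Bool; true; false; _∨_; _∧_; if_then_else_)
open import Data.List using (List; []; _∷_; foldr; allFin)
open import Data.Nat.ListAction using (sum)
open import Data.Sum using (inj₁; inj₂)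
open import Relation.Nullary.Decidable using (⌊_⌋)
open import Relation.Binary.PropositionalEquality using (_≡_)
open import Function.Bundles using (_⤖_; Bijection)
open import Function.Definitions using (Injective)
open import Data.Product using (Σ)
import Data.Nat as ℕ

Graph : ℕ → Set
Graph v = Fin v → Fin v → Bool

nbhd : {v : ℕ} → Graph v → Fin v → List (Fin v)
nbhd {v} G x = foldr (λ y ys → if G x y then y ∷ ys else ys) [] (allFin v)

-- A labeling is a bijection  f : Fin v ⤖ Fin v ; the label of vertex x is
-- toℕ (f x) + 1 ∈ {1,…,v}.
label : {v : ℕ} → (Fin v ⤖ Fin v) → Fin v → ℕ
label f x = suc (toℕ (Bijection.to f x))

weight : {v : ℕ} → Graph v → (Fin v ⤖ Fin v) → Fin v → ℕ
weight G f x = sum (Data.List.map (label f) (nbhd G x))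

IsDistanceAntimagicLabeling : {v : ℕ} → Graph v → (Fin v ⤖ Fin v) → Set
IsDistanceAntimagicLabeling G f = Injective _≡_ _≡_ (weight G f)

DistanceAntimagic : {v : ℕ} → Graph v → Set
DistanceAntimagic {v} G = Σ (Fin v ⤖ Fin v) (IsDistanceAntimagicLabeling G)

_==_ : ℕ → ℕ → Bool
m == n = ⌊ m ℕ.≟ n ⌋

-- Adjacency in the cycle C_n on vertices 0,…,n-1 : i ~ j iff j ≡ i+1 (mod n)
-- or i ≡ j+1 (mod n), i.e. succMod n i = j or succMod n j = i.   (Used for n ≥ 3.)
-- Written without mod: j = i+1, or i = j+1, or {i,j} = {n-1, 0}.
succMod : ℕ → ℕ → ℕ
succMod n i = if suc i == n then 0 else suc i

cycleAdj : (n : ℕ) → Fin n → Fin n → Bool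
cycleAdj n i j = (succMod n (toℕ i) == toℕ j) ∨ (succMod n (toℕ j) == toℕ i)

-- The sun S_n on 2n vertices Fin (n + n): vertices 0,…,n-1 (left part of
-- splitAt) are the cycle vertices c_0,…,c_{n-1}; vertices n,…,2n-1 are the
-- leaves l_0,…,l_{n-1}, with l_i attached to c_i.
sunAdj : (n : ℕ) → Graph (n + n)
sunAdj n x y with splitAt n x | splitAt n y
... | inj₁ i | inj₁ j = cycleAdj n i j
... | inj₁ i | inj₂ j = toℕ i == toℕ j
... | inj₂ i | inj₁ j = toℕ i == toℕ j
... | inj₂ i | inj₂ j = false

-- Label the cycle vertex c_i by i + 1 and the leaf l_i by 2n − i.  A leaf sees
-- only its cycle vertex, so the leaf weights are 1, …, n.  The weight of c_i is
-- (i + 2) + i + (2n − i) = 2n + 2 + i for 0 < i < n − 1, while the wrap-around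
-- gives 3n + 2 at c_0 and 2n + 1 at c_{n−1}; these are distinct and exceed n.
module Submission where

open import Defs
open import Data.Nat using (ℕ; zero; suc; _+_; _∸_; _<_; _≤_; _≥_; z≤n; s≤s; s≤s⁻¹)
import Data.Nat as ℕ
open import Data.Nat.Properties
  using (+-0-commutativeMonoid; +-assoc; +-identityʳ; +-cancelˡ-≡; <-irrefl; <⇒≢;
         m≤n⇒m<n∨m≡n; m∸n+n≡m; m+n∸n≡m; n∸n≡0; m≤m+n; m≤n+m; suc-injective;
         m≢1+n+m; ≤-trans; ≤-<-trans; <-trans; ≤∧≢⇒<; n<1+n)
open import Data.Nat.Tactic.RingSolver using (solve-∀)
import Data.Fin as Fin
open import Data.Fin using (Fin; toℕ; fromℕ<; splitAt; join; _↑ˡ_; _↑ʳ_; opposite; punchIn)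
open import Data.Fin.Properties
  using (toℕ-injective; toℕ-fromℕ<; toℕ<n; toℕ-↑ˡ; toℕ-↑ʳ; splitAt-↑ˡ; splitAt-↑ʳ;
         splitAt⁻¹-↑ˡ; splitAt⁻¹-↑ʳ; opposite-prop; opposite-involutive; punchInᵢ≢i)
open import Data.Vec.Functional using (Vector)
open import Algebra.Properties.CommutativeMonoid.Sum +-0-commutativeMonoid
  using (sum-syntax; sum-cong-≗; sum-remove; sum-replicate-zero; ∑-distrib-+)
  renaming (sum to ∑)
open import Data.Bool using (Bool; true; false; _∨_; if_then_else_)
open import Data.List using (List; []; _∷_; foldr; map; tabulate; allFin)
open import Data.List.Properties using (map-tabulate)
open import Data.Nat.ListAction using (sum)
open import Data.Sum using (inj₁; inj₂)
import Data.Sum as Sum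
open import Data.Product using (_,_)
open import Data.Empty using (⊥; ⊥-elim)
open import Relation.Nullary using (yes; no)
open import Relation.Nullary.Decidable using (isYes≗does; dec-true; dec-false)
open import Relation.Binary.PropositionalEquality
open import Function.Base using (_∘_; id)
open import Function.Bundles using (_⤖_; mk↔ₛ′)
open import Function.Definitions using (Injective)
open import Function.Properties.Inverse using (↔⇒⤖)

==⇒≡ : ∀ {m n} → (m == n) ≡ true → m ≡ n
==⇒≡ {m} {n} eq with m ℕ.≟ n
... | yes m≡n = m≡n

≡⇒== : ∀ {m n} → m ≡ n → (m == n) ≡ true
≡⇒== {m} {n} m≡n = trans (isYes≗does (m ℕ.≟ n)) (dec-true (m ℕ.≟ n) m≡n)

≢⇒== : ∀ {m n} → m ≢ n → (m == n) ≡ false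
≢⇒== {m} {n} m≢n = trans (isYes≗does (m ℕ.≟ n)) (dec-false (m ℕ.≟ n) m≢n)

if-∨ : ∀ (b c : Bool) (x : ℕ) → (b ≡ true → c ≡ true → ⊥) →
       (if b ∨ c then x else 0) ≡ (if b then x else 0) + (if c then x else 0)
if-∨ true  true  x disjoint = ⊥-elim (disjoint refl refl)
if-∨ true  false x disjoint = sym (+-identityʳ x)
if-∨ false c     x disjoint = refl

∑-↑ : ∀ m n (t : Vector ℕ (m + n)) →
      ∑ t ≡ ∑[ i < m ] t (i ↑ˡ n) + ∑[ j < n ] t (m ↑ʳ j)
∑-↑ zero    n t = refl
∑-↑ (suc m) n t = trans (cong (t Fin.zero +_) (∑-↑ m n (t ∘ Fin.suc))) (sym (+-assoc (t Fin.zero) _ _))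

∑-point : ∀ {k} (t : Vector ℕ k) i → (∀ j → j ≢ i → t j ≡ 0) → ∑ t ≡ t i
∑-point {suc k} t i vanish = begin
  ∑ t                        ≡⟨ sum-remove t ⟩
  t i + ∑ (t ∘ punchIn i)    ≡⟨ cong (t i +_) ∑-rest≡0 ⟩
  t i + 0                    ≡⟨ +-identityʳ (t i) ⟩
  t i                        ∎
  where
  open ≡-Reasoning
  ∑-rest≡0 : ∑ (t ∘ punchIn i) ≡ 0
  ∑-rest≡0 = trans (sum-cong-≗ (λ j → vanish (punchIn i j) (punchInᵢ≢i i j)))
                   (sum-replicate-zero k)

∑-if-unique : ∀ {k a} (p : ℕ → Bool) (g : ℕ → ℕ) → a < k →
              p a ≡ true → (∀ b → p b ≡ true → b ≡ a) →
              ∑[ j < k ] (if p (toℕ j) then g (toℕ j) else 0) ≡ g a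
∑-if-unique {k} {a} p g a<k pa unique = begin
  ∑[ j < k ] (if p (toℕ j) then g (toℕ j) else 0) ≡⟨ ∑-point _ (fromℕ< a<k) vanish ⟩
  (if p (toℕ â) then g (toℕ â) else 0)            ≡⟨ cong (λ b → if p b then g b else 0) (toℕ-fromℕ< a<k) ⟩
  (if p a then g a else 0)                        ≡⟨ cong (λ c → if c then g a else 0) pa ⟩
  g a                                             ∎
  where
  open ≡-Reasoning
  â = fromℕ< a<k
  vanish : ∀ j → j ≢ â → (if p (toℕ j) then g (toℕ j) else 0) ≡ 0
  vanish j j≢â with p (toℕ j) in pj
  ... | true  = ⊥-elim (j≢â (toℕ-injective (trans (unique (toℕ j) pj) (sym (toℕ-fromℕ< a<k)))))
  ... | false = refl

sum-tabulate : ∀ {k} (t : Vector ℕ k) → sum (tabulate t) ≡ ∑ t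
sum-tabulate {zero}  t = refl
sum-tabulate {suc k} t = cong (t Fin.zero +_) (sum-tabulate (t ∘ Fin.suc))

sum-map-filter : ∀ {A : Set} (P : A → Bool) (g : A → ℕ) (xs : List A) →
                 sum (map g (foldr (λ y ys → if P y then y ∷ ys else ys) [] xs))
                   ≡ sum (map (λ y → if P y then g y else 0) xs)
sum-map-filter P g []       = refl
sum-map-filter P g (y ∷ xs) with P y
... | true  = cong (g y +_) (sum-map-filter P g xs)
... | false = sum-map-filter P g xs

weight≡∑ : ∀ {v} (G : Graph v) (f : Fin v ⤖ Fin v) x →
           weight G f x ≡ ∑[ y < v ] (if G x y then label f y else 0)
weight≡∑ {v} G f x = begin
  weight G f x               ≡⟨ sum-map-filter (G x) (label f) (allFin v) ⟩
  sum (map t (allFin v))     ≡⟨ cong sum (map-tabulate id t) ⟩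
  sum (tabulate t)           ≡⟨ sum-tabulate t ⟩
  ∑ t                        ∎
  where
  open ≡-Reasoning
  t : Vector ℕ v
  t y = if G x y then label f y else 0

weight-↑ : ∀ {m n} (G : Graph (m + n)) (f : Fin (m + n) ⤖ Fin (m + n)) x →
           weight G f x ≡ ∑[ i < m ] (if G x (i ↑ˡ n) then label f (i ↑ˡ n) else 0)
                          + ∑[ j < n ] (if G x (m ↑ʳ j) then label f (m ↑ʳ j) else 0)
weight-↑ {m} {n} G f x = trans (weight≡∑ G f x) (∑-↑ m n _)

data SplitView (m n : ℕ) : Fin (m + n) → Set where
  left  : (i : Fin m) → SplitView m n (i ↑ˡ n)
  right : (j : Fin n) → SplitView m n (m ↑ʳ j)

splitView : ∀ m {n} (x : Fin (m + n)) → SplitView m n x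
splitView m x with splitAt m x in eq
... | inj₁ i = subst (SplitView m _) (splitAt⁻¹-↑ˡ eq) (left i)
... | inj₂ j = subst (SplitView m _) (splitAt⁻¹-↑ʳ eq) (right j)

injective-by-halves : ∀ {m n} {A : Set} (f : Fin (m + n) → A) →
                      (∀ {i j} → f (i ↑ˡ n) ≡ f (j ↑ˡ n) → i ≡ j) →
                      (∀ {i j} → f (m ↑ʳ i) ≡ f (m ↑ʳ j) → i ≡ j) →
                      (∀ i j → f (i ↑ˡ n) ≢ f (m ↑ʳ j)) →
                      Injective _≡_ _≡_ f
injective-by-halves {m} f injˡ injʳ apart {x} {y} fx≡fy
  with splitView m x | splitView m y
... | left i  | left j  = cong (_↑ˡ _) (injˡ fx≡fy)
... | left i  | right j = ⊥-elim (apart i j fx≡fy)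
... | right i | left j  = ⊥-elim (apart j i (sym fx≡fy))
... | right i | right j = cong (m ↑ʳ_) (injʳ fx≡fy)

predMod : ℕ → ℕ → ℕ
predMod n zero    = n ∸ 1
predMod n (suc a) = a

succMod-last : ∀ a → succMod (suc a) a ≡ 0
succMod-last a = cong (λ c → if c then 0 else suc a) (≡⇒== refl)

succMod-inner : ∀ {n a} → suc a < n → succMod n a ≡ suc a
succMod-inner {a = a} 1+a<n = cong (λ c → if c then 0 else suc a) (≢⇒== (<⇒≢ 1+a<n))

succMod<n : ∀ {n a} → a < n → succMod n a < n
succMod<n {n} {a} a<n with suc a ℕ.≟ n
... | yes _      = ≤-trans (s≤s z≤n) a<n
... | no 1+a≢n   = ≤∧≢⇒< a<n 1+a≢n

predMod<n : ∀ {n a} → a < n → predMod n a < n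
predMod<n {suc n} {zero}  _     = n<1+n n
predMod<n         {a = suc a} a<n = <-trans (n<1+n a) a<n

succMod-predMod : ∀ {n a} → a < n → succMod n (predMod n a) ≡ a
succMod-predMod {suc n} {zero}  _   = succMod-last n
succMod-predMod         {a = suc a} a<n = succMod-inner a<n

succMod≡⇒≡predMod : ∀ {n a b} → succMod n b ≡ a → b ≡ predMod n a
succMod≡⇒≡predMod {n} {b = b} eq with suc b ℕ.≟ n | eq
... | yes refl | refl = refl
... | no _     | refl = refl

succMod≢predMod : ∀ {n} a → 3 ≤ n → succMod n a ≢ predMod n a
succMod≢predMod zero (s≤s (s≤s (s≤s _))) = λ ()
succMod≢predMod {n} (suc a) 3≤n with suc (suc a) ℕ.≟ n
... | yes refl = λ 0≡a → <-irrefl 0≡a (s≤s⁻¹ (s≤s⁻¹ 3≤n))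
... | no _     = λ 2+a≡a → m≢1+n+m a (sym 2+a≡a)

∑-cycleAdj : ∀ {n} → 3 ≤ n → (i : Fin n) (g : ℕ → ℕ) →
             ∑[ j < n ] (if cycleAdj n i j then g (toℕ j) else 0)
               ≡ g (succMod n (toℕ i)) + g (predMod n (toℕ i))
∑-cycleAdj {n} 3≤n i g = begin
  ∑[ j < n ] (if cycleAdj n i j then g (toℕ j) else 0)
    ≡⟨ sum-cong-≗ {n} (λ j → if-∨ (isNext (toℕ j)) (isPrev (toℕ j)) (g (toℕ j)) (disjoint (toℕ j))) ⟩
  ∑[ j < n ] (toNext j + toPrev j)
    ≡⟨ ∑-distrib-+ toNext toPrev ⟩
  ∑ toNext + ∑ toPrev
    ≡⟨ cong₂ _+_
         (∑-if-unique isNext g (succMod<n a<n) (≡⇒== refl) (λ _ next → sym (==⇒≡ next)))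
         (∑-if-unique isPrev g (predMod<n a<n) (≡⇒== (succMod-predMod a<n))
                      (λ _ prev → succMod≡⇒≡predMod (==⇒≡ prev))) ⟩
  g (succMod n a) + g (predMod n a)
    ∎
  where
  open ≡-Reasoning
  a = toℕ i
  a<n = toℕ<n i
  isNext isPrev : ℕ → Bool
  isNext b = succMod n a == b
  isPrev b = succMod n b == a
  toNext toPrev : Vector ℕ n
  toNext j = if isNext (toℕ j) then g (toℕ j) else 0
  toPrev j = if isPrev (toℕ j) then g (toℕ j) else 0
  disjoint : ∀ b → isNext b ≡ true → isPrev b ≡ true → ⊥
  disjoint b next prev = succMod≢predMod a 3≤n (trans (==⇒≡ next) (succMod≡⇒≡predMod (==⇒≡ prev)))

module _ (n : ℕ) (i j : Fin n) where

  sunAdj-cycle-cycle : sunAdj n (i ↑ˡ n) (j ↑ˡ n) ≡ cycleAdj n i j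
  sunAdj-cycle-cycle rewrite splitAt-↑ˡ n i n | splitAt-↑ˡ n j n = refl

  sunAdj-cycle-leaf : sunAdj n (i ↑ˡ n) (n ↑ʳ j) ≡ (toℕ i == toℕ j)
  sunAdj-cycle-leaf rewrite splitAt-↑ˡ n i n | splitAt-↑ʳ n n j = refl

  sunAdj-leaf-cycle : sunAdj n (n ↑ʳ i) (j ↑ˡ n) ≡ (toℕ i == toℕ j)
  sunAdj-leaf-cycle rewrite splitAt-↑ʳ n n i | splitAt-↑ˡ n j n = refl

  sunAdj-leaf-leaf : sunAdj n (n ↑ʳ i) (n ↑ʳ j) ≡ false
  sunAdj-leaf-leaf rewrite splitAt-↑ʳ n n i | splitAt-↑ʳ n n j = refl

sunLabelMap : ∀ n → Fin (n + n) → Fin (n + n)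
sunLabelMap n x = join n n (Sum.map₂ opposite (splitAt n x))

sunLabelMap-cycle : ∀ n (i : Fin n) → sunLabelMap n (i ↑ˡ n) ≡ i ↑ˡ n
sunLabelMap-cycle n i rewrite splitAt-↑ˡ n i n = refl

sunLabelMap-leaf : ∀ n (i : Fin n) → sunLabelMap n (n ↑ʳ i) ≡ n ↑ʳ opposite i
sunLabelMap-leaf n i rewrite splitAt-↑ʳ n n i = refl

sunLabelMap-involutive : ∀ n x → sunLabelMap n (sunLabelMap n x) ≡ x
sunLabelMap-involutive n x with splitView n x
... | left i  = trans (cong (sunLabelMap n) (sunLabelMap-cycle n i)) (sunLabelMap-cycle n i)
... | right i = begin
  sunLabelMap n (sunLabelMap n (n ↑ʳ i))   ≡⟨ cong (sunLabelMap n) (sunLabelMap-leaf n i) ⟩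
  sunLabelMap n (n ↑ʳ opposite i)          ≡⟨ sunLabelMap-leaf n (opposite i) ⟩
  n ↑ʳ opposite (opposite i)               ≡⟨ cong (n ↑ʳ_) (opposite-involutive i) ⟩
  n ↑ʳ i                                   ∎
  where open ≡-Reasoning

sunLabeling : ∀ n → Fin (n + n) ⤖ Fin (n + n)
sunLabeling n = ↔⇒⤖ (mk↔ₛ′ (sunLabelMap n) (sunLabelMap n)
                            (sunLabelMap-involutive n) (sunLabelMap-involutive n))

-- 2n − a
leafLabel : ℕ → ℕ → ℕ
leafLabel n a = suc (n + (n ∸ suc a))

label-cycle : ∀ n (i : Fin n) → label (sunLabeling n) (i ↑ˡ n) ≡ suc (toℕ i)
label-cycle n i = cong suc (trans (cong toℕ (sunLabelMap-cycle n i)) (toℕ-↑ˡ i n))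

label-leaf : ∀ n (i : Fin n) → label (sunLabeling n) (n ↑ʳ i) ≡ leafLabel n (toℕ i)
label-leaf n i = cong suc (begin
  toℕ (sunLabelMap n (n ↑ʳ i))   ≡⟨ cong toℕ (sunLabelMap-leaf n i) ⟩
  toℕ (n ↑ʳ opposite i)          ≡⟨ toℕ-↑ʳ n (opposite i) ⟩
  n + toℕ (opposite i)           ≡⟨ cong (n +_) (opposite-prop i) ⟩
  n + (n ∸ suc (toℕ i))          ∎)
  where open ≡-Reasoning

cycleWeight : ℕ → ℕ → ℕ
cycleWeight n a = suc (succMod n a) + suc (predMod n a) + leafLabel n a

module _ (n : ℕ) (i : Fin n) where
  private
    select : Bool → ℕ → ℕ
    select b x = if b then x else 0
    open ≡-Reasoning

  weight-leaf : weight (sunAdj n) (sunLabeling n) (n ↑ʳ i) ≡ suc (toℕ i)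
  weight-leaf = begin
    weight (sunAdj n) (sunLabeling n) (n ↑ʳ i)
      ≡⟨ weight-↑ {n} {n} (sunAdj n) (sunLabeling n) (n ↑ʳ i) ⟩
    ∑[ j < n ] select (sunAdj n (n ↑ʳ i) (j ↑ˡ n)) (label (sunLabeling n) (j ↑ˡ n))
      + ∑[ j < n ] select (sunAdj n (n ↑ʳ i) (n ↑ʳ j)) (label (sunLabeling n) (n ↑ʳ j))
      ≡⟨ cong₂ _+_ (sum-cong-≗ {n} (λ j → cong₂ select (sunAdj-leaf-cycle n i j) (label-cycle n j)))
                   (sum-cong-≗ {n} (λ j → cong (λ b → select b (label (sunLabeling n) (n ↑ʳ j)))
                                                 (sunAdj-leaf-leaf n i j))) ⟩
    ∑[ j < n ] select (toℕ i == toℕ j) (suc (toℕ j)) + ∑[ j < n ] 0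
      ≡⟨ cong₂ _+_ (∑-if-unique (toℕ i ==_) suc (toℕ<n i) (≡⇒== refl) (λ _ e → sym (==⇒≡ e)))
                   (sum-replicate-zero n) ⟩
    suc (toℕ i) + 0
      ≡⟨ +-identityʳ _ ⟩
    suc (toℕ i)
      ∎

  weight-cycle : 3 ≤ n → weight (sunAdj n) (sunLabeling n) (i ↑ˡ n) ≡ cycleWeight n (toℕ i)
  weight-cycle 3≤n = begin
    weight (sunAdj n) (sunLabeling n) (i ↑ˡ n)
      ≡⟨ weight-↑ {n} {n} (sunAdj n) (sunLabeling n) (i ↑ˡ n) ⟩
    ∑[ j < n ] select (sunAdj n (i ↑ˡ n) (j ↑ˡ n)) (label (sunLabeling n) (j ↑ˡ n))
      + ∑[ j < n ] select (sunAdj n (i ↑ˡ n) (n ↑ʳ j)) (label (sunLabeling n) (n ↑ʳ j))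
      ≡⟨ cong₂ _+_ (sum-cong-≗ {n} (λ j → cong₂ select (sunAdj-cycle-cycle n i j) (label-cycle n j)))
                   (sum-cong-≗ {n} (λ j → cong₂ select (sunAdj-cycle-leaf n i j) (label-leaf n j))) ⟩
    ∑[ j < n ] select (cycleAdj n i j) (suc (toℕ j))
      + ∑[ j < n ] select (toℕ i == toℕ j) (leafLabel n (toℕ j))
      ≡⟨ cong₂ _+_ (∑-cycleAdj 3≤n i suc)
                   (∑-if-unique (toℕ i ==_) (leafLabel n) (toℕ<n i) (≡⇒== refl) (λ _ e → sym (==⇒≡ e))) ⟩
    cycleWeight n (toℕ i)
      ∎

-- A vertex a of C_{3+m}: 0, where predMod wraps around; an inner vertex; or
-- 2 + m = n − 1, where succMod wraps around.
data CyclePosition (m : ℕ) : ℕ → Set where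
  first : CyclePosition m 0
  inner : ∀ k d → d + k ≡ m → CyclePosition m (suc k)
  last  : CyclePosition m (suc (suc m))

cyclePosition : ∀ {m a} → a < 3 + m → CyclePosition m a
cyclePosition {a = zero}  _   = first
cyclePosition {a = suc a} a<n with m≤n⇒m<n∨m≡n (s≤s⁻¹ (s≤s⁻¹ a<n))
... | inj₁ a<1+m = inner a _ (m∸n+n≡m (s≤s⁻¹ a<1+m))
... | inj₂ refl  = last

offset : ∀ {m a} → CyclePosition m a → ℕ
offset {m} first = 4 + m
offset (inner k _ _) = 2 + k
offset last = 0

cycleWeight-offset : ∀ {m a} (p : CyclePosition m a) → cycleWeight (3 + m) a ≡ 7 + (m + m) + offset p
cycleWeight-offset {m} first = lemma m
  where
  lemma : ∀ m → 2 + (3 + m) + suc (3 + m + (2 + m)) ≡ 7 + (m + m) + (4 + m)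
  lemma = solve-∀
cycleWeight-offset (inner k d refl) = trans
  (cong₂ (λ s r → suc s + suc k + suc (3 + (d + k) + r))
         (succMod-inner (s≤s (s≤s (s≤s (m≤n+m k d))))) (m+n∸n≡m (suc d) k))
  (lemma k d)
  where
  lemma : ∀ k d → suc (2 + k) + suc k + suc (3 + (d + k) + suc d)
                    ≡ 7 + ((d + k) + (d + k)) + (2 + k)
  lemma = solve-∀
cycleWeight-offset {m} last = trans
  (cong₂ (λ s r → suc s + suc (suc m) + suc (3 + m + r)) (succMod-last (2 + m)) (n∸n≡0 m))
  (lemma m)
  where
  lemma : ∀ m → 1 + suc (suc m) + suc (3 + m + 0) ≡ 7 + (m + m) + 0
  lemma = solve-∀

offset-injective : ∀ {m a b} (p : CyclePosition m a) (q : CyclePosition m b) →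
                   offset p ≡ offset q → a ≡ b
offset-injective first            first            _  = refl
offset-injective first            (inner k _ refl) eq = ⊥-elim (m≢1+n+m k (sym (suc-injective (suc-injective eq))))
offset-injective first            last             ()
offset-injective (inner k _ refl) first            eq = ⊥-elim (m≢1+n+m k (suc-injective (suc-injective eq)))
offset-injective (inner _ _ _)    (inner _ _ _)    eq = cong suc (suc-injective (suc-injective eq))
offset-injective (inner _ _ _)    last             ()
offset-injective last             first            ()
offset-injective last             (inner _ _ _)    ()
offset-injective last             last             _  = refl

cycleWeight-injective : ∀ {n a b} → 3 ≤ n → a < n → b < n →
                        cycleWeight n a ≡ cycleWeight n b → a ≡ b
cycleWeight-injective (s≤s (s≤s (s≤s {n = m} _))) a<n b<n eq =
  offset-injective p q (+-cancelˡ-≡ (7 + (m + m)) _ _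
    (trans (sym (cycleWeight-offset p)) (trans eq (cycleWeight-offset q))))
  where
  p = cyclePosition a<n
  q = cyclePosition b<n

n<cycleWeight : ∀ n a → n < cycleWeight n a
n<cycleWeight n a = ≤-trans (s≤s (m≤m+n n (n ∸ suc a))) (m≤n+m _ (suc (succMod n a) + suc (predMod n a)))

mainTheorem7 : (n : ℕ) → n ≥ 3 → DistanceAntimagic (sunAdj n)
mainTheorem7 n 3≤n = sunLabeling n , injective-by-halves w cycle-injective leaf-injective cycle≢leaf
  where
  w = weight (sunAdj n) (sunLabeling n)

  cycle-injective : ∀ {i j} → w (i ↑ˡ n) ≡ w (j ↑ˡ n) → i ≡ j
  cycle-injective {i} {j} eq = toℕ-injective (cycleWeight-injective 3≤n (toℕ<n i) (toℕ<n j)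
    (trans (sym (weight-cycle n i 3≤n)) (trans eq (weight-cycle n j 3≤n))))

  leaf-injective : ∀ {i j} → w (n ↑ʳ i) ≡ w (n ↑ʳ j) → i ≡ j
  leaf-injective {i} {j} eq = toℕ-injective (suc-injective
    (trans (sym (weight-leaf n i)) (trans eq (weight-leaf n j))))

  cycle≢leaf : ∀ i j → w (i ↑ˡ n) ≢ w (n ↑ʳ j)
  cycle≢leaf i j eq = <⇒≢ (≤-<-trans (toℕ<n j) (n<cycleWeight n (toℕ i)))
    (trans (sym (weight-leaf n j)) (trans (sym eq) (weight-cycle n i 3≤n)))
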